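{- Let $G$ be a graph, $p\in\mathbb{N}$ and $q\in\mathbb{N}\cup\{\infty\}$. Every $(p,q)$-spreading set $S$ of $G$ contains a vertex $v$ such that $|N_S(v)|\geq \deg_G(v)-q$.
   Context: All graphs are finite, simple and undirected. For $S\subseteq V(G)$ and $v\in V(G)$, $N_S(v)=\{u\in S: uv\in E(G)\}$. Vertices are colored white or blue. Spreading color change rule with parameters $p\in\mathbb{N}$, $q\in\mathbb{N}\cup\{\infty\}$: if a white vertex $w$ has at least $p$ blue neighbors, and one of the blue neighbors of $w$ has at most $q$ white neighbors, then $w$ is recolored blue. A set $S\subseteq V(G)$ is a $(p,q)$-spreading set if, when exactly the vertices of $S$ are initially blue, repeated application of this rule eventually makes all vertices blue. -}

module Defs where

open import Data.Nat using (ℕ; zero; suc; _≤_; _∸_)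
open import Data.Bool using (Bool; true; false)
open import Data.Fin using (Fin)
open import Data.Fin.Subset using (Subset; _∈_; _∉_; ∁; _∩_; _∪_; ⁅_⁆; ∣_∣; ⊤)
open import Data.Vec using (tabulate)
open import Data.Product using (Σ; ∃; _×_; _,_)
open import Data.Unit using () renaming (⊤ to Unit)
open import Relation.Binary.PropositionalEquality using (_≡_)
open import Relation.Binary.Construct.Closure.ReflexiveTransitive using (Star)

record Graph (n : ℕ) : Set where
  field
    adj     : Fin n → Fin n → Bool
    adj-sym : ∀ u v → adj u v ≡ adj v u
    adj-irr : ∀ v → adj v v ≡ false

open Graph public

N : ∀ {n} → Graph n → Fin n → Subset n
N G v = tabulate (adj G v)

N[_] : ∀ {n} → Graph n → Subset n → Fin n → Subset n
N[ G ] S v = N G v ∩ S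

deg : ∀ {n} → Graph n → Fin n → ℕ
deg G v = ∣ N G v ∣

data ℕ∞ : Set where
  fin : ℕ → ℕ∞
  ∞   : ℕ∞

_≤∞_ : ℕ → ℕ∞ → Set
m ≤∞ fin q = m ≤ q
m ≤∞ ∞     = Unit

-- m - q as a lower bound: m - ∞ = -∞, represented by 0 (every count is ≥ it)
_∸∞_ : ℕ → ℕ∞ → ℕ
m ∸∞ fin q = m ∸ q
m ∸∞ ∞     = 0

-- One application of the (p,q)-spreading colour change rule; B is the
-- current set of blue vertices, w the white vertex that turns blue.
data Step {n : ℕ} (G : Graph n) (p : ℕ) (q : ℕ∞) (B : Subset n) : Subset n → Set where
  spread : (w : Fin n) → w ∉ B
         → p ≤ ∣ N[ G ] B w ∣
         → (u : Fin n) → u ∈ N[ G ] B w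
         → ∣ N[ G ] (∁ B) u ∣ ≤∞ q
         → Step G p q B (⁅ w ⁆ ∪ B)

IsSpreadingSet : ∀ {n} → Graph n → ℕ → ℕ∞ → Subset n → Set
IsSpreadingSet G p q S = Star (Step G p q) S ⊤

-- If S is already everything, any vertex works.  Otherwise the first application of the
-- colour change rule uses a blue vertex u ∈ S with at most q white neighbours, and since
-- deg u = |N_S(u)| + |N_{V∖S}(u)|, this u satisfies |N_S(u)| ≥ deg u − q.
module Submission where

open import Defs
open import Data.Nat using (ℕ; suc; _≤_; _+_; z≤n)
open import Data.Nat.Properties using (≤-trans; ≤-reflexive; ∸-monoʳ-≤; m+n∸n≡m; m∸n≤m; +-suc)
open import Data.Bool using (true; false)
open import Data.Fin using (zero)
open import Data.Fin.Subset using (Subset; _∈_; ∣_∣; _∩_; ∁; ⊤)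
open import Data.Fin.Subset.Properties using (∈⊤; x∈p∩q⁻; ∩-identityʳ)
open import Data.Vec using ([]; _∷_)
open import Data.Product using (∃; _×_; _,_; proj₂)
open import Relation.Binary.PropositionalEquality using (_≡_; refl; sym; trans; cong; subst)
open import Relation.Binary.Construct.Closure.ReflexiveTransitive using (ε; _◅_)

∣p∣≡∣p∩q∣+∣p∩∁q∣ : ∀ {n} (p q : Subset n) → ∣ p ∣ ≡ ∣ p ∩ q ∣ + ∣ p ∩ ∁ q ∣
∣p∣≡∣p∩q∣+∣p∩∁q∣ []          []          = refl
∣p∣≡∣p∩q∣+∣p∩∁q∣ (false ∷ p) (_ ∷ q)     = ∣p∣≡∣p∩q∣+∣p∩∁q∣ p q
∣p∣≡∣p∩q∣+∣p∩∁q∣ (true ∷ p)  (true ∷ q)  = cong suc (∣p∣≡∣p∩q∣+∣p∩∁q∣ p q)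
∣p∣≡∣p∩q∣+∣p∩∁q∣ (true ∷ p)  (false ∷ q) =
  trans (cong suc (∣p∣≡∣p∩q∣+∣p∩∁q∣ p q)) (sym (+-suc _ _))

m∸∞q≤m : ∀ m q → m ∸∞ q ≤ m
m∸∞q≤m m (fin q) = m∸n≤m m q
m∸∞q≤m m ∞       = z≤n

m+n∸∞q≤m : ∀ m n q → n ≤∞ q → (m + n) ∸∞ q ≤ m
m+n∸∞q≤m m n (fin q) n≤q = ≤-trans (∸-monoʳ-≤ (m + n) n≤q) (≤-reflexive (m+n∸n≡m m n))
m+n∸∞q≤m m n ∞       _   = z≤n

module _ {n} (G : Graph n) (q : ℕ∞) where

  deg≡∣N[S]∣+∣N[∁S]∣ : ∀ S v → deg G v ≡ ∣ N[ G ] S v ∣ + ∣ N[ G ] (∁ S) v ∣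
  deg≡∣N[S]∣+∣N[∁S]∣ S v = ∣p∣≡∣p∩q∣+∣p∩∁q∣ (N G v) S

  deg∸∞q≤∣N[⊤]∣ : ∀ v → deg G v ∸∞ q ≤ ∣ N[ G ] ⊤ v ∣
  deg∸∞q≤∣N[⊤]∣ v = subst (λ X → deg G v ∸∞ q ≤ ∣ X ∣) (sym (∩-identityʳ (N G v))) (m∸∞q≤m (deg G v) q)

  ∣N[∁S]∣≤∞q⇒deg∸∞q≤∣N[S]∣ : ∀ S v → ∣ N[ G ] (∁ S) v ∣ ≤∞ q → deg G v ∸∞ q ≤ ∣ N[ G ] S v ∣
  ∣N[∁S]∣≤∞q⇒deg∸∞q≤∣N[S]∣ S v few-white =
    subst (λ d → d ∸∞ q ≤ ∣ N[ G ] S v ∣) (sym (deg≡∣N[S]∣+∣N[∁S]∣ S v))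
          (m+n∸∞q≤m _ _ q few-white)

lemma2p2 : ∀ {n} (G : Graph (suc n)) (p : ℕ) (q : ℕ∞) (S : Subset (suc n))
           → IsSpreadingSet G p q S
           → ∃ λ v → v ∈ S × (deg G v ∸∞ q) ≤ ∣ N[ G ] S v ∣
lemma2p2 G p q .⊤ ε = zero , ∈⊤ , deg∸∞q≤∣N[⊤]∣ G q zero
lemma2p2 G p q S (spread w _ _ u u∈N[S]w few-white ◅ _) =
  u , proj₂ (x∈p∩q⁻ (N G w) S u∈N[S]w) , ∣N[∁S]∣≤∞q⇒deg∸∞q≤∣N[S]∣ G q S u few-white
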